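{- Let $(i_1,j_1),(i_2,j_2),\dots,(i_k,j_k)$ be pairs of integers satisfying: $1\le k\le n$; $1\le i_1<i_2<\cdots<i_k=n$; $1=j_1<j_2<\cdots<j_k$; and $j_s\le i_{s-1}+1$ for all $2\le s\le k$. Consider the following procedure defining a map $\sigma$ on $[n]$. First set $\sigma(i_s)=j_s$ for all $s\in\{1,\dots,k\}$. Then, for each $i\in[n]\setminus\{i_1,\dots,i_k\}$ taken in decreasing order, let $s$ be such that $i_{s-1}<i<i_s$ (with $i_0=0$); with $\sigma$ denoting the partial injective map defined so far, set $\sigma(i)=\sigma^{ -t}(j_s)$, where $t$ is the smallest positive integer such that $\sigma^{ -t}(j_s)$ is defined and has not yet been assigned as the image of any integer. Then this procedure is well defined: at every step such an integer $t$ exists.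
   Context: $[n]=\{1,\dots,n\}$. During the procedure, $\sigma$ is a partially defined injective map on $[n]$; $\sigma^{ -1}(y)$ denotes the unique $x$ with $\sigma(x)=y$ already defined, and $\sigma^{ -t}(y)=\sigma^{ -1}(\sigma^{ -(t-1)}(y))$ (defined only when each intermediate preimage exists). -}

module Defs where

open import Data.Nat using (ℕ; zero; suc; _+_; _∸_; _≤_; _<_; _≡ᵇ_)
open import Data.Maybe using (Maybe; just; nothing)
open import Data.Bool using (if_then_else_)
open import Data.Product using (Σ; ∃; _×_; _,_)
open import Relation.Binary.PropositionalEquality using (_≡_; _≢_)
open import Relation.Nullary using (¬_)

-- A partial map on [n] is represented as ℕ → Maybe ℕ
-- (σ x ≡ nothing means σ(x) is not (yet) defined).
PMap : Set
PMap = ℕ → Maybe ℕ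

-- Iter σ t y x  means  σ^{-t}(y) is defined and equals x.
data Iter (σ : PMap) : ℕ → ℕ → ℕ → Set where
  iter-zero : ∀ {y} → Iter σ zero y y
  iter-suc  : ∀ {t y z x} → Iter σ t y z → σ x ≡ just z → Iter σ (suc t) y x

Good : PMap → ℕ → ℕ → Set
Good σ y t = ∃ λ x → Iter σ t y x × (∀ w → σ w ≢ just x)

MinT : PMap → ℕ → ℕ → Set
MinT σ y t = 1 ≤ t × Good σ y t × (∀ t′ → 1 ≤ t′ → t′ < t → ¬ Good σ y t′)

ext0 : (ℕ → ℕ) → ℕ → ℕ
ext0 i zero = 0
ext0 i (suc s) = i (suc s)

update : PMap → ℕ → ℕ → PMap
update σ a b x = if x ≡ᵇ a then just b else σ x

InitMap : ℕ → (ℕ → ℕ) → (ℕ → ℕ) → PMap → Set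
InitMap k i j σ =
  ∀ x y → (σ x ≡ just y → Σ ℕ λ s → 1 ≤ s × s ≤ k × x ≡ i s × y ≡ j s)
        × ((Σ ℕ λ s → 1 ≤ s × s ≤ k × x ≡ i s × y ≡ j s) → σ x ≡ just y)

-- Run n k i j m σ : the procedure has processed every integer in [n] greater
-- than m (in decreasing order), and σ is the partial map defined so far.
data Run (n k : ℕ) (i j : ℕ → ℕ) : ℕ → PMap → Set where
  run-init : ∀ {σ} → InitMap k i j σ → Run n k i j n σ
  -- m+1 is one of i_1,…,i_k : its value was already set.
  run-skip : ∀ {m σ} s → 1 ≤ s → s ≤ k → suc m ≡ i s →
             Run n k i j (suc m) σ → Run n k i j m σ
  run-step : ∀ {m σ} s t x → 1 ≤ s → s ≤ k →
             ext0 i (s ∸ 1) < suc m → suc m < i s →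
             MinT σ (j s) t → Iter σ t (j s) x →
             Run n k i j (suc m) σ → Run n k i j m (update σ (suc m) x)

{-# OPTIONS --safe #-}
module Submission where

-- Throughout the procedure σ is defined only on [n], σ(i_r) = j_r for every r,
-- and on the not yet processed points ≤ m+1 it consists of these pairs only.
-- Starting from j_s, σ therefore maps a value j_r < i_r to a strictly smaller
-- value of the same kind, so no forward orbit returns to j_s.  Hence the points
-- σ^{-1}(j_s) = i_s, σ^{-2}(j_s), … are pairwise distinct elements of [n]; the
-- chain cannot have n+2 terms, so some σ^{-t}(j_s) with t ≥ 1 has no preimage,
-- and the least such t is found by a bounded search.

open import Defs
open import Data.Nat using (ℕ; zero; suc; _+_; _∸_; _≤_; _<_; z≤n; s≤s; _≟_; _<?_; _≡ᵇ_)
open import Data.Nat.Properties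
open import Data.Bool using (true; false; T)
open import Data.Unit using (tt)
open import Data.Empty using (⊥)
open import Data.Product using (∃; ∃₂; _×_; _,_; proj₁; proj₂)
open import Data.Maybe using (Maybe; just; _>>=_)
import Data.Maybe.Properties as Maybe
open import Data.Sum using (inj₁; inj₂)
open import Data.Fin as Fin using (Fin; toℕ; fromℕ<)
open import Data.Fin.Properties using (pigeonhole; toℕ<n; fromℕ<-injective)
open import Relation.Nullary using (¬_; Dec; yes; no; contradiction)
open import Relation.Nullary.Decidable using (map′; _×-dec_; ¬?)
open import Relation.Binary.PropositionalEquality
open import Relation.Binary.Definitions using (tri<; tri≈; tri>)

update-other : ∀ σ a b {x} → x ≢ a → update σ a b x ≡ σ x
update-other σ a b {x} x≢a with x ≡ᵇ a in e
... | true  = contradiction (≡ᵇ⇒≡ x a (subst T (sym e) tt)) x≢a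
... | false = refl

iterate : PMap → ℕ → ℕ → Maybe ℕ
iterate σ zero    x = just x
iterate σ (suc t) x = σ x >>= iterate σ t

module _ {σ : PMap} where

  Iter⇒iterate : ∀ {t y x} → Iter σ t y x → iterate σ t x ≡ just y
  Iter⇒iterate iter-zero          = refl
  Iter⇒iterate (iter-suc it σx≡z) rewrite σx≡z = Iter⇒iterate it

  iterate⇒Iter : ∀ {y} t x → iterate σ t x ≡ just y → Iter σ t y x
  iterate⇒Iter zero    x refl = iter-zero
  iterate⇒Iter (suc t) x eq with σ x in σx≡z
  ... | just z = iter-suc (iterate⇒Iter t z eq) σx≡z

  iterate-+ : ∀ a d x {z} → iterate σ a x ≡ just z → iterate σ (a + d) x ≡ iterate σ d z
  iterate-+ zero    d x refl = refl
  iterate-+ (suc a) d x eq with σ x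
  ... | just w = iterate-+ a d w eq

Acyclic : PMap → ℕ → Set
Acyclic σ y = ∀ d → iterate σ (suc d) y ≢ just y

DomainBelow : ℕ → PMap → Set
DomainBelow n σ = ∀ x y → σ x ≡ just y → x ≤ n

module _ {σ : PMap} {y : ℕ} (acyclic : Acyclic σ y) where

  acyclic⇒¬Iter-deeper : ∀ {a b x} → a < b → Iter σ a y x → Iter σ b y x → ⊥
  acyclic⇒¬Iter-deeper {a} {b} {x} a<b ia ib = acyclic d (begin
      iterate σ (suc d) y     ≡⟨ iterate-+ a (suc d) x (Iter⇒iterate ia) ⟨
      iterate σ (a + suc d) x ≡⟨ cong (λ c → iterate σ c x) a+1+d≡b ⟩
      iterate σ b x           ≡⟨ Iter⇒iterate ib ⟩
      just y                  ∎)
    where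
    open ≡-Reasoning
    d : ℕ
    d = proj₁ (m≤n⇒∃[o]m+o≡n a<b)
    a+1+d≡b : a + suc d ≡ b
    a+1+d≡b = trans (+-suc a d) (proj₂ (m≤n⇒∃[o]m+o≡n a<b))

Least : (ℕ → Set) → ℕ → Set
Least P t = 1 ≤ t × P t × (∀ t′ → 1 ≤ t′ → t′ < t → ¬ P t′)

least-search : {P : ℕ → Set} → (∀ t → Dec (P (suc t))) →
               ∀ fuel b → (∀ t → 1 ≤ t → t ≤ b → ¬ P t) → P (suc (fuel + b)) → ∃ (Least P)
least-search P? fuel b none p with P? b
... | yes pb = suc b , s≤s z≤n , pb , λ t 1≤t t<1+b → none t 1≤t (≤-pred t<1+b)
least-search P? zero     b none p | no ¬pb = contradiction p ¬pb
least-search {P} P? (suc fuel) b none p | no ¬pb =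
  least-search P? fuel (suc b) none′ (subst (λ c → P (suc c)) (sym (+-suc fuel b)) p)
  where
  none′ : ∀ t → 1 ≤ t → t ≤ suc b → ¬ P t
  none′ t 1≤t t≤1+b with m≤n⇒m<n∨m≡n t≤1+b
  ... | inj₁ t<1+b = none t 1≤t (≤-pred t<1+b)
  ... | inj₂ refl  = ¬pb

least-exists : {P : ℕ → Set} → (∀ t → Dec (P (suc t))) → ∀ t → P (suc t) → ∃ (Least P)
least-exists {P} P? t p =
  least-search P? t 0 (λ t′ 1≤t′ t′≤0 _ → <⇒≱ 1≤t′ t′≤0)
               (subst (λ c → P (suc c)) (sym (+-identityʳ t)) p)

module _ {n : ℕ} {σ : PMap} (domain : DomainBelow n σ) where

  Iter-suc⇒≤ : ∀ {t y x} → Iter σ (suc t) y x → x ≤ n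
  Iter-suc⇒≤ (iter-suc _ σx≡z) = domain _ _ σx≡z

  image? : ∀ x → Dec (∃ λ w → σ w ≡ just x)
  image? x = map′ (λ (w , _ , σw≡x) → w , σw≡x)
                  (λ (w , σw≡x) → w , s≤s (domain w x σw≡x) , σw≡x)
                  (anyUpTo? (λ w → Maybe.≡-dec _≟_ (σ w) (just x)) (suc n))

  Good? : ∀ y t → Dec (Good σ y (suc t))
  Good? y t = map′
    (λ (x , _ , σᵗx≡y , ∉image) → x , iterate⇒Iter (suc t) x σᵗx≡y , λ w σw≡x → ∉image (w , σw≡x))
    (λ (x , it , ∉image) → x , s≤s (Iter-suc⇒≤ it) , Iter⇒iterate it , λ (w , σw≡x) → ∉image w σw≡x)
    (anyUpTo? (λ x → Maybe.≡-dec _≟_ (iterate σ (suc t) x) (just y) ×-dec ¬? (image? x)) (suc n))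

  module _ {y : ℕ} (acyclic : Acyclic σ y) {x₀ : ℕ} (σx₀≡y : σ x₀ ≡ just y) where

    backward-orbit : ∀ {N} → (∀ t → t < N → ¬ Good σ y (suc t)) →
                     ∀ a → a ≤ N → ∃ λ x → Iter σ (suc a) y x
    backward-orbit none zero    _     = x₀ , iter-suc iter-zero σx₀≡y
    backward-orbit none (suc a) 1+a≤N with backward-orbit none a (≤-trans (n≤1+n a) 1+a≤N)
    ... | x , it with image? x
    ...   | yes (w , σw≡x) = w , iter-suc it σw≡x
    ...   | no  ∉image     = contradiction (x , it , λ w σw≡x → ∉image (w , σw≡x)) (none a 1+a≤N)

    -- Otherwise the backward orbit has n+2 points in [0, n]; two of them coincide,
    -- which closes a cycle through y.
    no-good-impossible : ¬ (∀ t → t < suc n → ¬ Good σ y (suc t))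
    no-good-impossible none = collision (pigeonhole ≤-refl position)
      where
      orbit : (a : Fin (suc (suc n))) → ∃ λ x → Iter σ (suc (toℕ a)) y x
      orbit a = backward-orbit none (toℕ a) (≤-pred (toℕ<n a))
      position : Fin (suc (suc n)) → Fin (suc n)
      position a = fromℕ< (s≤s (Iter-suc⇒≤ (proj₂ (orbit a))))
      collision : ¬ ∃₂ λ p q → p Fin.< q × position p ≡ position q
      collision (p , q , p<q , same-position) =
        acyclic⇒¬Iter-deeper acyclic (s≤s p<q)
          (subst (Iter σ _ y) (fromℕ<-injective _ _ _ _ same-position) (proj₂ (orbit p)))
          (proj₂ (orbit q))

    least-good : ∃ (Least (Good σ y))
    least-good with anyUpTo? (Good? y) (suc n)
    ... | yes (t , _ , good) = least-exists (Good? y) t good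
    ... | no  no-good        = contradiction (λ t t<1+n good → no-good (t , t<1+n , good)) no-good-impossible

StrictlyIncreasing : ℕ → (ℕ → ℕ) → Set
StrictlyIncreasing k f = ∀ s → 1 ≤ s → s < k → f s < f (suc s)

module _ {k : ℕ} {f : ℕ → ℕ} (increasing : StrictlyIncreasing k f) where

  increasing⇒< : ∀ {r r′} → 1 ≤ r → r < r′ → r′ ≤ k → f r < f r′
  increasing⇒< {r} {suc r′} 1≤r (s≤s r≤r′) r′<k with m≤n⇒m<n∨m≡n r≤r′
  ... | inj₁ r<r′ = <-trans (increasing⇒< 1≤r r<r′ (<⇒≤ r′<k)) (increasing r′ (≤-trans 1≤r r≤r′) r′<k)
  ... | inj₂ refl = increasing r 1≤r r′<k

  increasing⇒≤ : ∀ {r r′} → 1 ≤ r → r ≤ r′ → r′ ≤ k → f r ≤ f r′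
  increasing⇒≤ 1≤r r≤r′ r′≤k with m≤n⇒m<n∨m≡n r≤r′
  ... | inj₁ r<r′ = <⇒≤ (increasing⇒< 1≤r r<r′ r′≤k)
  ... | inj₂ refl = ≤-refl

  increasing-reflects-< : ∀ {r r′} → 1 ≤ r′ → r ≤ k → f r < f r′ → r < r′
  increasing-reflects-< {r} {r′} 1≤r′ r≤k fr<fr′ with r <? r′
  ... | yes r<r′ = r<r′
  ... | no  r≮r′ = contradiction (increasing⇒≤ 1≤r′ (≮⇒≥ r≮r′) r≤k) (<⇒≱ fr<fr′)

module Procedure (n k : ℕ) (i j : ℕ → ℕ)
  (i-increasing : StrictlyIncreasing k i) (iₖ≡n : i k ≡ n)
  (j₁≡1 : j 1 ≡ 1) (j-increasing : StrictlyIncreasing k j)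
  (j-bound : ∀ s → 2 ≤ s → s ≤ k → j s ≤ i (s ∸ 1) + 1) where

  i≤n : ∀ {r} → 1 ≤ r → r ≤ k → i r ≤ n
  i≤n 1≤r r≤k = subst (i _ ≤_) iₖ≡n (increasing⇒≤ i-increasing 1≤r r≤k ≤-refl)

  jₛ≤ : ∀ {s v} → 1 ≤ s → s ≤ k → ext0 i (s ∸ 1) < v → j s ≤ v
  jₛ≤ {suc zero}    _ _   1≤v  = subst (_≤ _) (sym j₁≡1) 1≤v
  jₛ≤ {suc (suc q)} {v} _ s≤k i<v =
    ≤-trans (j-bound (suc (suc q)) (s≤s (s≤s z≤n)) s≤k) (subst (_≤ v) (+-comm 1 (i (suc q))) i<v)

  i∉gap : ∀ {r s v} → 1 ≤ r → r ≤ k → 1 ≤ s → s ≤ k →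
          ext0 i (s ∸ 1) < v → v < i s → i r ≢ v
  i∉gap {r} {s} 1≤r r≤k 1≤s s≤k lo hi refl with <-cmp r s
  ... | tri≈ _ refl _ = <-irrefl refl hi
  ... | tri> _ _ s<r  = <-asym hi (increasing⇒< i-increasing 1≤s s<r r≤k)
  i∉gap {suc r} {suc (suc q)} 1≤r r≤k 1≤s s≤k lo hi refl | tri< (s≤s r≤q) _ _ =
    <⇒≱ lo (increasing⇒≤ i-increasing 1≤r r≤q (≤-trans (n≤1+n (suc q)) s≤k))
  i∉gap {suc r} {suc zero} 1≤r r≤k 1≤s s≤k lo hi refl | tri< (s≤s ()) _ _

  record Invariant (u : ℕ) (σ : PMap) : Set where
    field
      domain      : DomainBelow n σ
      unprocessed : ∀ {x y} → x ≤ u → σ x ≡ just y →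
                    ∃ λ r → 1 ≤ r × r ≤ k × x ≡ i r × y ≡ j r
      initial     : ∀ {r} → 1 ≤ r → r ≤ k → σ (i r) ≡ just (j r)
      u≤n         : u ≤ n

  invariant : ∀ {u σ} → Run n k i j u σ → Invariant u σ
  invariant (run-init init) = record
    { domain      = λ x y σx≡y → let (r , 1≤r , r≤k , x≡iᵣ , _) = proj₁ (init x y) σx≡y
                                 in subst (_≤ n) (sym x≡iᵣ) (i≤n 1≤r r≤k)
    ; unprocessed = λ {x} {y} _ → proj₁ (init x y)
    ; initial     = λ {r} 1≤r r≤k → proj₂ (init (i r) (j r)) (r , 1≤r , r≤k , refl , refl)
    ; u≤n         = ≤-refl
    }
  invariant (run-skip _ _ _ _ run) = record
    { domain      = domain
    ; unprocessed = λ x≤m → unprocessed (m≤n⇒m≤1+n x≤m)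
    ; initial     = initial
    ; u≤n         = ≤-trans (n≤1+n _) u≤n
    }
    where open Invariant (invariant run)
  invariant {m} (run-step {σ = σ} s _ x 1≤s s≤k lo hi _ _ run) = record
    { domain      = domain′
    ; unprocessed = unprocessed′
    ; initial     = λ 1≤r r≤k →
        trans (update-other σ (suc m) x (i∉gap 1≤r r≤k 1≤s s≤k lo hi)) (initial 1≤r r≤k)
    ; u≤n         = ≤-trans (n≤1+n _) u≤n
    }
    where
    open Invariant (invariant run)
    domain′ : DomainBelow n (update σ (suc m) x)
    domain′ x′ y σ′x′≡y with x′ ≟ suc m
    ... | yes refl = u≤n
    ... | no  x′≢1+m = domain x′ y (trans (sym (update-other σ (suc m) x x′≢1+m)) σ′x′≡y)
    unprocessed′ : ∀ {x′ y} → x′ ≤ m → update σ (suc m) x x′ ≡ just y →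
                   ∃ λ r → 1 ≤ r × r ≤ k × x′ ≡ i r × y ≡ j r
    unprocessed′ x′≤m σ′x′≡y = unprocessed (m≤n⇒m≤1+n x′≤m)
      (trans (sym (update-other σ (suc m) x (<⇒≢ (s≤s x′≤m)))) σ′x′≡y)

  module _ {m : ℕ} {σ : PMap} (inv : Invariant (suc m) σ) where
    open Invariant inv

    Descending : ℕ → Set
    Descending v = v ≤ suc m × ∃ λ r → 1 ≤ r × r ≤ k × v ≡ j r × v < i r

    -- σ v = j_{r′} where v = i_{r′}; since i_{r′} = v < i_r forces r′ < r, also j_{r′} < j_r = v.
    descending-step : ∀ {v w} → Descending v → σ v ≡ just w → w < v × Descending w
    descending-step (v≤1+m , r , 1≤r , r≤k , v≡jᵣ , v<iᵣ) σv≡w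
      with unprocessed v≤1+m σv≡w
    ... | r′ , 1≤r′ , r′≤k , refl , refl =
      jᵣ′<iᵣ′ , ≤-trans (<⇒≤ jᵣ′<iᵣ′) v≤1+m , r′ , 1≤r′ , r′≤k , refl , jᵣ′<iᵣ′
      where
      r′<r : r′ < r
      r′<r = increasing-reflects-< i-increasing 1≤r r′≤k v<iᵣ
      jᵣ′<iᵣ′ : j r′ < i r′
      jᵣ′<iᵣ′ = subst (j r′ <_) (sym v≡jᵣ) (increasing⇒< j-increasing 1≤r′ r′<r r≤k)

    descending-iterate : ∀ {v z} d → Descending v → iterate σ (suc d) v ≡ just z → z < v
    descending-iterate {v} d desc σᵈ⁺¹v≡z with σ v in σv≡w
    ... | just w with descending-step desc σv≡w
    descending-iterate zero    _ refl | just w | w<v , _      = w<v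
    descending-iterate (suc d) _ eq   | just w | w<v , desc-w = <-trans (descending-iterate d desc-w eq) w<v

    descending⇒acyclic : ∀ {v} → Descending v → Acyclic σ v
    descending⇒acyclic desc d σᵈ⁺¹v≡v = <-irrefl refl (descending-iterate d desc σᵈ⁺¹v≡v)

    jₛ-descending : ∀ {s} → 1 ≤ s → s ≤ k → ext0 i (s ∸ 1) < suc m → suc m < i s → Descending (j s)
    jₛ-descending {s} 1≤s s≤k lo hi = jₛ≤1+m , s , 1≤s , s≤k , refl , ≤-<-trans jₛ≤1+m hi
      where
      jₛ≤1+m : j s ≤ suc m
      jₛ≤1+m = jₛ≤ 1≤s s≤k lo

lemma4p1 : (n k : ℕ) (i j : ℕ → ℕ) →
    1 ≤ k → k ≤ n →
    1 ≤ i 1 →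
    (∀ s → 1 ≤ s → s < k → i s < i (suc s)) →
    i k ≡ n →
    j 1 ≡ 1 →
    (∀ s → 1 ≤ s → s < k → j s < j (suc s)) →
    (∀ s → 2 ≤ s → s ≤ k → j s ≤ i (s ∸ 1) + 1) →
    ∀ m σ → Run n k i j (suc m) σ →
    ∀ s → 1 ≤ s → s ≤ k → ext0 i (s ∸ 1) < suc m → suc m < i s →
    ∃ λ t → MinT σ (j s) t
lemma4p1 n k i j _ _ _ i-increasing iₖ≡n j₁≡1 j-increasing j-bound m σ run s 1≤s s≤k lo hi =
  least-good domain (descending⇒acyclic inv (jₛ-descending inv 1≤s s≤k lo hi)) (initial 1≤s s≤k)
  where
  open Procedure n k i j i-increasing iₖ≡n j₁≡1 j-increasing j-bound
  inv : Invariant (suc m) σ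
  inv = invariant run
  open Invariant inv
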